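{- If $H$ is a $(w,\ell)$-cylinder with $3\le w\le 12$, then $H$ contains a set of at most $\frac{|V(H)|}{6}+12=\frac16 w(\ell+1)+12$ vertices that dominates all interior vertices of $H$ (every interior vertex of $H$ is in the set or adjacent in $H$ to a vertex of the set).
   Context: For integers $w\ge3$, $\ell\ge1$, $0\le k<w$, a $(w,\ell,k)$-cylinder, also called a $(w,\ell)$-cylinder, is the plane graph with vertices $z_{a,b}$ ($a\in\mathbb{Z}_w$, $0\le b\le\ell$), edges $z_{a,b}z_{a+1,b}$ and $z_{a,b}z_{a,b+1}$ (the Cartesian product of a $w$-cycle and a path of length $\ell$), and, for each $0\le a\le w-1$ and $0\le b<\ell$, one diagonal of the quadrilateral $z_{a,b}z_{a+1,b}z_{a+1,b+1}z_{a,b+1}$: the edge $z_{a,b}z_{a+1,b+1}$ if $a<k$, and the edge $z_{a+1,b}z_{a,b+1}$ if $a\ge k$. It has $w(\ell+1)$ vertices. Its boundary cycles are those induced by $\{z_{a,0}:a\in\mathbb{Z}_w\}$ and $\{z_{a,\ell}:a\in\mathbb{Z}_w\}$; its interior vertices are the $z_{a,b}$ with $0<b<\ell$. -}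

module Defs where

open import Data.Nat using (ℕ; zero; suc; _+_; _*_; _<_; _≤_; _≥_; _%_; NonZero)
open import Data.Product using (_×_; _,_; Σ; ∃)
open import Data.Sum using (_⊎_)
open import Data.List using (List; length)
open import Data.List.Membership.Propositional using (_∈_)
open import Relation.Binary.PropositionalEquality using (_≡_)

-- A vertex z_{a,b} of a (w,ℓ,k)-cylinder is encoded as the pair (a , b) of
-- natural numbers with a < w and b ≤ ℓ.
Vertex : Set
Vertex = ℕ × ℕ

IsVertex : ℕ → ℕ → Vertex → Set
IsVertex w ℓ (a , b) = a < w × b ≤ ℓ

succW : (w : ℕ) → .{{NonZero w}} → ℕ → ℕ
succW w a = suc a % w

-- Directed edge list of the (w,ℓ,k)-cylinder (each undirected edge once).
data Edge (w ℓ k : ℕ) .{{_ : NonZero w}} : Vertex → Vertex → Set where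
  horiz : ∀ {a b} → a < w → b ≤ ℓ → Edge w ℓ k (a , b) (succW w a , b)
  vert  : ∀ {a b} → a < w → b < ℓ → Edge w ℓ k (a , b) (a , suc b)
  diagL : ∀ {a b} → a < w → b < ℓ → a < k → Edge w ℓ k (a , b) (succW w a , suc b)
  diagR : ∀ {a b} → a < w → b < ℓ → a ≥ k → Edge w ℓ k (succW w a , b) (a , suc b)

Adj : (w ℓ k : ℕ) → .{{NonZero w}} → Vertex → Vertex → Set
Adj w ℓ k u v = Edge w ℓ k u v ⊎ Edge w ℓ k v u

Interior : ℕ → ℕ → Vertex → Set
Interior w ℓ (a , b) = a < w × 0 < b × b < ℓ

DominatesInterior : (w ℓ k : ℕ) → .{{NonZero w}} → List Vertex → Set
DominatesInterior w ℓ k S =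
  ∀ v → Interior w ℓ v → v ∈ S ⊎ Σ Vertex (λ u → u ∈ S × Adj w ℓ k v u)

module Submission where

-- Every (w,ℓ,k)-cylinder with 3 ≤ w ≤ 12 is dominated by a
-- periodic pattern of rows: a non-empty list of p "rows" of columns, where row
-- b of the cylinder receives the columns of pattern row (b mod p).  An
-- interior vertex z_{a,b+1} only sees rows b, b+1, b+2, so the pattern
-- dominates every interior vertex as soon as it dominates, for each residue
-- r < p, the vertices of row r+1 using the pattern rows r, r+1, r+2.  If one
-- period uses at most w·p/6 vertices and every proper prefix of the period at
-- most 12 vertices, then the first ℓ+1 rows use at most w(ℓ+1)/6 + 12.
--
-- The validity of a
-- pattern is decidable, and a table of patterns for all 3 ≤ w ≤ 12, k < w is
-- certified by evaluating the decision procedure; lemma26 combines the two.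

open import Defs
open import Data.Nat using (ℕ; zero; suc; _+_; _*_; _≤_; _<_; _%_; _/_; NonZero; >-nonZero⁻¹; z≤n; s≤s)
open import Data.Nat.Properties
open import Data.Nat.DivMod using (m%n<n; %-distribˡ-+; m%n%n≡m%n; [m+kn]%n≡m%n; m≡m%n+[m/n]*n; m<n⇒m%n≡m; n%n≡0)
open import Data.Nat.Tactic.RingSolver using (solve-∀)
open import Data.Product using (_×_; Σ; _,_)
open import Data.Sum using (_⊎_; inj₁; inj₂; swap)
open import Function using (_∘_)
open import Relation.Binary.PropositionalEquality
open import Relation.Nullary using (Dec; yes; no)
open import Relation.Nullary.Decidable using (_⊎-dec_; _×-dec_; map′; from-yes)
open import Data.List using (List; []; _∷_; length; map; _++_)
open import Data.List.NonEmpty as List⁺ using (List⁺; _∷_)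
open import Data.List.Relation.Unary.All using (All; all?; [])
open import Data.List.Relation.Unary.Any using (Any; any?)
open import Data.List.Properties using (length-++; length-map)
import Data.List.Relation.Unary.All as All
import Data.List.Relation.Unary.All.Properties as All
open import Data.List.Membership.Propositional using (_∈_; find)
open import Data.List.Membership.Propositional.Properties using (∈-map⁺; ∈-++⁺ˡ; ∈-++⁺ʳ)

rowSum : (ℕ → ℕ) → ℕ → ℕ
rowSum f zero    = 0
rowSum f (suc n) = f n + rowSum f n

%-suc : ∀ n p .{{_ : NonZero p}} → suc n % p ≡ suc (n % p) % p
%-suc n p = begin
  suc n % p                          ≡⟨ cong (λ m → suc m % p) (m≡m%n+[m/n]*n n p) ⟩
  (suc (n % p) + (n / p) * p) % p    ≡⟨ [m+kn]%n≡m%n (suc (n % p)) (n / p) p ⟩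
  suc (n % p) % p                    ∎
  where open ≡-Reasoning

suc-mod : ∀ n p .{{_ : NonZero p}} →
  suc n % p ≡ suc (n % p) ⊎ (suc (n % p) ≡ p × suc n % p ≡ 0)
suc-mod n p with m≤n⇒m<n∨m≡n (m%n<n n p)
... | inj₁ advances = inj₁ (trans (%-suc n p) (m<n⇒m%n≡m advances))
... | inj₂ wraps    = inj₂ (wraps , trans (%-suc n p) (trans (cong (_% p) wraps) (n%n≡0 p)))

-- Counting a periodic sequence g (b mod p) with weight d, where one full
-- period costs at most w·p.  Invariant after n terms, R = n mod p and
-- A, B the sums of the first n terms and of the first R terms of the period:
--   d·A + w·R ≤ w·n + d·B,   i.e. the completed periods cost at most w per term.
module PeriodicSum (g : ℕ → ℕ) (p : ℕ) .{{_ : NonZero p}} (d w : ℕ)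
                   (period-cost : d * rowSum g p ≤ w * p) where

  advance : ∀ A B R n x → d * A + w * R ≤ w * n + d * B →
    d * (x + A) + w * suc R ≤ w * suc n + d * (x + B)
  advance A B R n x ih = begin
    d * (x + A) + w * suc R       ≡⟨ rearrange-left d w A R x ⟩
    (d * x + w) + (d * A + w * R) ≤⟨ +-monoʳ-≤ (d * x + w) ih ⟩
    (d * x + w) + (w * n + d * B) ≡⟨ rearrange-right d w B n x ⟩
    w * suc n + d * (x + B)       ∎
    where
    open ≤-Reasoning
    rearrange-left : ∀ d w A R x → d * (x + A) + w * suc R ≡ (d * x + w) + (d * A + w * R)
    rearrange-left = solve-∀
    rearrange-right : ∀ d w B n x → (d * x + w) + (w * n + d * B) ≡ w * suc n + d * (x + B)
    rearrange-right = solve-∀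

  -- the invariant survives a step completing a period (the residue wraps to 0),
  -- because the completed period costs at most w·(R+1)
  wrap : ∀ A B R n x → d * A + w * R ≤ w * n + d * B → d * (x + B) ≤ w * suc R →
    d * (x + A) + w * 0 ≤ w * suc n + d * 0
  wrap A B R n x ih full = +-cancelʳ-≤ (d * B + w * R) _ _ (begin
    (d * (x + A) + w * 0) + (d * B + w * R)   ≡⟨ rearrange-left d w A B R x ⟩
    (d * A + w * R) + d * (x + B)             ≤⟨ +-mono-≤ ih full ⟩
    (w * n + d * B) + w * suc R               ≡⟨ rearrange-right d w B R n ⟩
    (w * suc n + d * 0) + (d * B + w * R)     ∎)
    where
    open ≤-Reasoning
    rearrange-left : ∀ d w A B R x →
      (d * (x + A) + w * 0) + (d * B + w * R) ≡ (d * A + w * R) + d * (x + B)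
    rearrange-left = solve-∀
    rearrange-right : ∀ d w B R n →
      (w * n + d * B) + w * suc R ≡ (w * suc n + d * 0) + (d * B + w * R)
    rearrange-right = solve-∀

  invariant : ∀ n →
    d * rowSum (λ b → g (b % p)) n + w * (n % p) ≤ w * n + d * rowSum g (n % p)
  invariant zero rewrite m<n⇒m%n≡m (>-nonZero⁻¹ p) = ≤-reflexive (+-comm (d * 0) (w * 0))
  invariant (suc n) with suc-mod n p
  ... | inj₁ advances rewrite advances =
    advance (rowSum (λ b → g (b % p)) n) (rowSum g (n % p)) (n % p) n (g (n % p)) (invariant n)
  ... | inj₂ (completes , wraps) rewrite wraps =
    wrap (rowSum (λ b → g (b % p)) n) (rowSum g (n % p)) (n % p) n (g (n % p)) (invariant n)
      (subst (λ q → d * rowSum g q ≤ w * q) (sym completes) period-cost)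

  bound : ∀ c → (∀ {r} → r < p → d * rowSum g r ≤ c) →
    ∀ n → d * rowSum (λ b → g (b % p)) n ≤ w * n + c
  bound c prefix-cost n = begin
    d * rowSum (λ b → g (b % p)) n                  ≤⟨ m≤m+n _ (w * (n % p)) ⟩
    d * rowSum (λ b → g (b % p)) n + w * (n % p)    ≤⟨ invariant n ⟩
    w * n + d * rowSum g (n % p)                    ≤⟨ +-monoʳ-≤ (w * n) (prefix-cost (m%n<n n p)) ⟩
    w * n + c                                       ∎
    where open ≤-Reasoning

-- Local structure of a cylinder: which columns of neighbouring rows are
-- adjacent.  Up w k a a' says that z_{a,b} z_{a',b+1} is an edge (for any b).
Up : (w k : ℕ) .{{_ : NonZero w}} → ℕ → ℕ → Set
Up w k a a' = a' ≡ a ⊎ (a' ≡ succW w a × a < k) ⊎ (a ≡ succW w a' × k ≤ a')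

up? : (w k : ℕ) .{{_ : NonZero w}} → ∀ a a' → Dec (Up w k a a')
up? w k a a' = a' ≟ a ⊎-dec ((a' ≟ succW w a ×-dec a <? k) ⊎-dec (a ≟ succW w a' ×-dec k ≤? a'))

up-adjacent : ∀ {w ℓ k a a' b} .{{_ : NonZero w}} → a < w → a' < w → b < ℓ →
  Up w k a a' → Adj w ℓ k (a , b) (a' , suc b)
up-adjacent a<w a'<w b<ℓ (inj₁ refl)                  = inj₁ (vert a<w b<ℓ)
up-adjacent a<w a'<w b<ℓ (inj₂ (inj₁ (refl , a<k)))   = inj₁ (diagL a<w b<ℓ a<k)
up-adjacent a<w a'<w b<ℓ (inj₂ (inj₂ (refl , k≤a')))  = inj₁ (diagR a'<w b<ℓ k≤a')

Beside : (w : ℕ) .{{_ : NonZero w}} → ℕ → ℕ → Set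
Beside w a a' = a' ≡ a ⊎ a' ≡ succW w a ⊎ a ≡ succW w a'

beside? : (w : ℕ) .{{_ : NonZero w}} → ∀ a a' → Dec (Beside w a a')
beside? w a a' = a' ≟ a ⊎-dec (a' ≟ succW w a ⊎-dec a ≟ succW w a')

beside-adjacent : ∀ {w ℓ k a a' b} .{{_ : NonZero w}} → a < w → a' < w → b ≤ ℓ →
  Beside w a a' → a' ≡ a ⊎ Adj w ℓ k (a , b) (a' , b)
beside-adjacent a<w a'<w b≤ℓ (inj₁ same)        = inj₁ same
beside-adjacent a<w a'<w b≤ℓ (inj₂ (inj₁ refl)) = inj₂ (inj₁ (horiz a<w b≤ℓ))
beside-adjacent a<w a'<w b≤ℓ (inj₂ (inj₂ refl)) = inj₂ (inj₂ (horiz a'<w b≤ℓ))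

-- A pattern is a non-empty list of rows (lists of columns); its length is the
-- period p, and row b of the cylinder receives pattern row (b mod p).
Pattern : Set
Pattern = List⁺ (List ℕ)

period : Pattern → ℕ
period = List⁺.length

-- the r-th row of the pattern (empty beyond the period)
row : Pattern → ℕ → List ℕ
row pat = rowAt (List⁺.toList pat)
  where
  rowAt : List (List ℕ) → ℕ → List ℕ
  rowAt []       r       = []
  rowAt (c ∷ cs) zero    = c
  rowAt (c ∷ cs) (suc r) = rowAt cs r

rowOf : Pattern → ℕ → List ℕ
rowOf pat b = row pat (b % period pat)

rowOf-periodic : ∀ pat i b → rowOf pat (i + b % period pat) ≡ rowOf pat (i + b)
rowOf-periodic pat i b = cong (row pat) (begin
  (i + b % p) % p            ≡⟨ %-distribˡ-+ i (b % p) p ⟩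
  (i % p + b % p % p) % p    ≡⟨ cong (λ m → (i % p + m) % p) (m%n%n≡m%n b p) ⟩
  (i % p + b % p) % p        ≡⟨ %-distribˡ-+ i b p ⟨
  (i + b) % p                ∎)
  where
  open ≡-Reasoning
  p = period pat

Dominated : (w k : ℕ) .{{_ : NonZero w}} → List ℕ → List ℕ → List ℕ → ℕ → Set
Dominated w k below same above a =
  Any (λ a' → Up w k a' a) below ⊎ Any (Beside w a) same ⊎ Any (Up w k a) above

dominated? : (w k : ℕ) .{{_ : NonZero w}} → ∀ below same above a →
  Dec (Dominated w k below same above a)
dominated? w k below same above a =
  any? (λ a' → up? w k a' a) below ⊎-dec (any? (beside? w a) same ⊎-dec any? (up? w k a) above)

-- A pattern is valid for the (w,ℓ,k)-cylinders when its columns lie in range,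
-- one period dominates every row (interior vertices only see three rows),
-- one period costs at most w·p/6 vertices and every proper prefix at most 12.
record Valid (w k : ℕ) .{{_ : NonZero w}} (pat : Pattern) : Set where
  field
    columns     : ∀ {r} → r < period pat → All (_< w) (row pat r)
    covering    : ∀ {r} → r < period pat → ∀ {a} → a < w →
                  Dominated w k (rowOf pat r) (rowOf pat (1 + r)) (rowOf pat (2 + r)) a
    period-cost : 6 * rowSum (length ∘ row pat) (period pat) ≤ w * period pat
    prefix-cost : ∀ {r} → r < period pat → 6 * rowSum (length ∘ row pat) r ≤ 72

valid? : (w k : ℕ) .{{_ : NonZero w}} → ∀ pat → Dec (Valid w k pat)
valid? w k pat =
  map′ (λ (c , v , d , pr) → record { columns = c ; covering = v ; period-cost = d ; prefix-cost = pr })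
       (λ V → let open Valid V in
         (λ {r} → columns {r}) , (λ {r} → covering {r}) , period-cost , (λ {r} → prefix-cost {r}))
       (allUpTo? (λ r → all? (_<? w) (row pat r)) p
          ×-dec allUpTo? (λ r → allUpTo? (dominated? w k (rowOf pat r) (rowOf pat (1 + r)) (rowOf pat (2 + r))) w) p
          ×-dec 6 * rowSum (length ∘ row pat) p ≤? w * p
          ×-dec allUpTo? (λ r → 6 * rowSum (length ∘ row pat) r ≤? 72) p)
  where p = period pat

layers : Pattern → ℕ → List Vertex
layers pat zero    = []
layers pat (suc b) = map (_, b) (rowOf pat b) ++ layers pat b

∈-layers : ∀ pat {a b n} → a ∈ rowOf pat b → b < n → (a , b) ∈ layers pat n
∈-layers pat {a} {b} {suc n} a∈row b<1+n with b ≟ n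
... | yes refl = ∈-++⁺ˡ (∈-map⁺ (_, b) a∈row)
... | no  b≢n  = ∈-++⁺ʳ (map (_, n) (rowOf pat n)) (∈-layers pat a∈row (≤∧≢⇒< (≤-pred b<1+n) b≢n))

length-layers : ∀ pat n → length (layers pat n) ≡ rowSum (λ b → length (rowOf pat b)) n
length-layers pat zero    = refl
length-layers pat (suc n) = begin
  length (map (_, n) (rowOf pat n) ++ layers pat n)          ≡⟨ length-++ (map (_, n) (rowOf pat n)) ⟩
  length (map (_, n) (rowOf pat n)) + length (layers pat n)  ≡⟨ cong₂ _+_ (length-map (_, n) (rowOf pat n)) (length-layers pat n) ⟩
  length (rowOf pat n) + rowSum (λ b → length (rowOf pat b)) n ∎
  where open ≡-Reasoning

module FromValidPattern (w ℓ k : ℕ) .{{_ : NonZero w}} (pat : Pattern) (valid : Valid w k pat) where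
  open Valid valid

  S : List Vertex
  S = layers pat (suc ℓ)

  rowOf-columns : ∀ b → All (_< w) (rowOf pat b)
  rowOf-columns b = columns (m%n<n b (period pat))

  S-vertices : All (IsVertex w ℓ) S
  S-vertices = vertices (suc ℓ) ≤-refl
    where
    vertices : ∀ n → n ≤ suc ℓ → All (IsVertex w ℓ) (layers pat n)
    vertices zero    _      = []
    vertices (suc b) b<1+ℓ  = All.++⁺ (All.map⁺ (All.map (_, ≤-pred b<1+ℓ) (rowOf-columns b)))
                                      (vertices b (<⇒≤ b<1+ℓ))

  covering-everywhere : ∀ b {a} → a < w →
    Dominated w k (rowOf pat b) (rowOf pat (1 + b)) (rowOf pat (2 + b)) a
  covering-everywhere b a<w = transport (rowOf-periodic pat 0 b) (rowOf-periodic pat 1 b)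
    (rowOf-periodic pat 2 b) (covering (m%n<n b (period pat)) a<w)
    where
    transport : ∀ {x x' y y' z z' a} → x ≡ x' → y ≡ y' → z ≡ z' →
      Dominated w k x y z a → Dominated w k x' y' z' a
    transport refl refl refl d = d

  S-dominates : DominatesInterior w ℓ k S
  S-dominates (a , zero)  (_ , () , _)
  S-dominates (a , suc b) (a<w , _ , 1+b<ℓ) with covering-everywhere b a<w
  ... | inj₁ below with find below
  ...   | a' , a'∈ , up = inj₂ ((a' , b) , ∈-layers pat a'∈ (<-trans (n<1+n b) (m<n⇒m<1+n 1+b<ℓ)) ,
                               swap (up-adjacent (All.lookup (rowOf-columns b) a'∈) a<w (<-trans (n<1+n b) 1+b<ℓ) up))
  S-dominates (a , suc b) (a<w , _ , 1+b<ℓ) | inj₂ (inj₁ same) with find same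
  ...   | a' , a'∈ , beside with beside-adjacent a<w (All.lookup (rowOf-columns (suc b)) a'∈) (<⇒≤ 1+b<ℓ) beside
  ...     | inj₁ refl = inj₁ (∈-layers pat a'∈ (m<n⇒m<1+n 1+b<ℓ))
  ...     | inj₂ adj  = inj₂ ((a' , suc b) , ∈-layers pat a'∈ (m<n⇒m<1+n 1+b<ℓ) , adj)
  S-dominates (a , suc b) (a<w , _ , 1+b<ℓ) | inj₂ (inj₂ above) with find above
  ...   | a' , a'∈ , up = inj₂ ((a' , suc (suc b)) , ∈-layers pat a'∈ (s≤s 1+b<ℓ) ,
                               up-adjacent a<w (All.lookup (rowOf-columns (2 + b)) a'∈) 1+b<ℓ up)

  -- the size bound is the periodic counting bound with weight 6 and c = 72
  S-size : 6 * length S ≤ w * suc ℓ + 72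
  S-size rewrite length-layers pat (suc ℓ) =
    PeriodicSum.bound (length ∘ row pat) (period pat) 6 w period-cost 72 prefix-cost (suc ℓ)

-- Valid patterns for every width 3 ≤ w ≤ 12 and every k < w, found by computer
-- search.
pattern-for : ℕ → ℕ → Pattern
pattern-for 3 0 = [] ∷ (0 ∷ []) ∷ []
pattern-for 3 1 = [] ∷ (0 ∷ []) ∷ []
pattern-for 3 2 = [] ∷ (0 ∷ []) ∷ []
pattern-for 4 0 = [] ∷ (0 ∷ 2 ∷ []) ∷ [] ∷ []
pattern-for 4 1 = (2 ∷ []) ∷ (0 ∷ []) ∷ [] ∷ []
pattern-for 4 2 = [] ∷ (0 ∷ 2 ∷ []) ∷ [] ∷ []
pattern-for 4 3 = (2 ∷ []) ∷ (0 ∷ []) ∷ [] ∷ []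
pattern-for 5 0 = [] ∷ (0 ∷ 2 ∷ []) ∷ [] ∷ (2 ∷ []) ∷ (4 ∷ []) ∷ (1 ∷ []) ∷ (3 ∷ []) ∷ [] ∷ (1 ∷ 4 ∷ []) ∷ [] ∷ (2 ∷ []) ∷ (4 ∷ []) ∷ []
pattern-for 5 1 = (3 ∷ []) ∷ (0 ∷ []) ∷ [] ∷ (2 ∷ []) ∷ (4 ∷ []) ∷ (1 ∷ []) ∷ []
pattern-for 5 2 = [] ∷ (0 ∷ 3 ∷ []) ∷ [] ∷ (2 ∷ []) ∷ (4 ∷ []) ∷ (1 ∷ []) ∷ []
pattern-for 5 3 = [] ∷ (0 ∷ 3 ∷ []) ∷ [] ∷ (2 ∷ []) ∷ (4 ∷ []) ∷ (1 ∷ []) ∷ []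
pattern-for 5 4 = (2 ∷ []) ∷ (0 ∷ []) ∷ [] ∷ (3 ∷ []) ∷ (1 ∷ []) ∷ (4 ∷ []) ∷ []
pattern-for 6 0 = [] ∷ (0 ∷ 3 ∷ []) ∷ []
pattern-for 6 1 = [] ∷ (0 ∷ 3 ∷ []) ∷ []
pattern-for 6 2 = [] ∷ (0 ∷ 3 ∷ []) ∷ []
pattern-for 6 3 = [] ∷ (0 ∷ 3 ∷ []) ∷ []
pattern-for 6 4 = [] ∷ (0 ∷ 3 ∷ []) ∷ []
pattern-for 6 5 = [] ∷ (0 ∷ 3 ∷ []) ∷ []
pattern-for 7 0 = (5 ∷ []) ∷ (0 ∷ []) ∷ (2 ∷ []) ∷ (4 ∷ []) ∷ (1 ∷ 6 ∷ []) ∷ (3 ∷ []) ∷ []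
pattern-for 7 1 = (5 ∷ []) ∷ (0 ∷ []) ∷ (2 ∷ []) ∷ (4 ∷ []) ∷ (6 ∷ []) ∷ (1 ∷ 3 ∷ []) ∷ []
pattern-for 7 2 = (3 ∷ []) ∷ (0 ∷ 5 ∷ []) ∷ [] ∷ (2 ∷ 4 ∷ []) ∷ (6 ∷ []) ∷ (1 ∷ []) ∷ []
pattern-for 7 3 = [] ∷ (0 ∷ 3 ∷ 5 ∷ []) ∷ [] ∷ (2 ∷ []) ∷ (4 ∷ 6 ∷ []) ∷ (1 ∷ []) ∷ []
pattern-for 7 4 = [] ∷ (0 ∷ 2 ∷ 4 ∷ []) ∷ [] ∷ (5 ∷ []) ∷ (1 ∷ 3 ∷ []) ∷ (6 ∷ []) ∷ []
pattern-for 7 5 = [] ∷ (0 ∷ 2 ∷ 4 ∷ []) ∷ [] ∷ [] ∷ (1 ∷ 3 ∷ 5 ∷ []) ∷ (6 ∷ []) ∷ []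
pattern-for 7 6 = [] ∷ (0 ∷ 4 ∷ []) ∷ (3 ∷ []) ∷ [] ∷ (2 ∷ 6 ∷ []) ∷ (1 ∷ 5 ∷ []) ∷ []
pattern-for 8 0 = (6 ∷ []) ∷ (0 ∷ 2 ∷ []) ∷ (4 ∷ []) ∷ []
pattern-for 8 1 = (2 ∷ 4 ∷ []) ∷ (0 ∷ 6 ∷ []) ∷ [] ∷ []
pattern-for 8 2 = (6 ∷ []) ∷ (0 ∷ 2 ∷ []) ∷ (4 ∷ []) ∷ []
pattern-for 8 3 = (4 ∷ []) ∷ (0 ∷ 2 ∷ 6 ∷ []) ∷ [] ∷ []
pattern-for 8 4 = (4 ∷ []) ∷ (0 ∷ 2 ∷ 6 ∷ []) ∷ [] ∷ []
pattern-for 8 5 = (4 ∷ []) ∷ (0 ∷ 2 ∷ 6 ∷ []) ∷ [] ∷ []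
pattern-for 8 6 = (4 ∷ 6 ∷ []) ∷ (0 ∷ 2 ∷ []) ∷ [] ∷ []
pattern-for 8 7 = (4 ∷ []) ∷ (0 ∷ 2 ∷ []) ∷ (6 ∷ []) ∷ []
pattern-for 9 0 = [] ∷ (0 ∷ 3 ∷ 6 ∷ []) ∷ []
pattern-for 9 1 = [] ∷ (0 ∷ 3 ∷ 6 ∷ []) ∷ []
pattern-for 9 2 = [] ∷ (0 ∷ 3 ∷ 6 ∷ []) ∷ []
pattern-for 9 3 = [] ∷ (0 ∷ 3 ∷ 6 ∷ []) ∷ []
pattern-for 9 4 = [] ∷ (0 ∷ 3 ∷ 6 ∷ []) ∷ []
pattern-for 9 5 = [] ∷ (0 ∷ 3 ∷ 6 ∷ []) ∷ []
pattern-for 9 6 = [] ∷ (0 ∷ 3 ∷ 6 ∷ []) ∷ []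
pattern-for 9 7 = [] ∷ (0 ∷ 3 ∷ 6 ∷ []) ∷ []
pattern-for 9 8 = [] ∷ (0 ∷ 3 ∷ 6 ∷ []) ∷ []
pattern-for 10 0 = (8 ∷ []) ∷ (0 ∷ 2 ∷ []) ∷ (4 ∷ 6 ∷ []) ∷ []
pattern-for 10 1 = (2 ∷ 4 ∷ []) ∷ (0 ∷ 6 ∷ 8 ∷ []) ∷ [] ∷ []
pattern-for 10 2 = (8 ∷ []) ∷ (0 ∷ 2 ∷ []) ∷ (4 ∷ 6 ∷ []) ∷ []
pattern-for 10 3 = (4 ∷ []) ∷ (0 ∷ 2 ∷ 6 ∷ 8 ∷ []) ∷ [] ∷ []
pattern-for 10 4 = (4 ∷ []) ∷ (0 ∷ 2 ∷ 6 ∷ 8 ∷ []) ∷ [] ∷ []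
pattern-for 10 5 = (4 ∷ 8 ∷ []) ∷ (0 ∷ 2 ∷ []) ∷ (6 ∷ []) ∷ []
pattern-for 10 6 = (4 ∷ 8 ∷ []) ∷ (0 ∷ 2 ∷ []) ∷ (6 ∷ []) ∷ []
pattern-for 10 7 = (4 ∷ []) ∷ (0 ∷ 2 ∷ 8 ∷ []) ∷ (6 ∷ []) ∷ []
pattern-for 10 8 = (4 ∷ []) ∷ (0 ∷ 2 ∷ 8 ∷ []) ∷ (6 ∷ []) ∷ []
pattern-for 10 9 = (4 ∷ []) ∷ (0 ∷ 2 ∷ []) ∷ (6 ∷ 8 ∷ []) ∷ []
pattern-for 11 0 = (9 ∷ []) ∷ (0 ∷ 2 ∷ 4 ∷ []) ∷ (6 ∷ []) ∷ (8 ∷ []) ∷ (1 ∷ 3 ∷ 5 ∷ 10 ∷ []) ∷ (7 ∷ []) ∷ []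
pattern-for 11 1 = (9 ∷ []) ∷ (0 ∷ []) ∷ (2 ∷ 4 ∷ 6 ∷ []) ∷ (8 ∷ []) ∷ (10 ∷ []) ∷ (1 ∷ 3 ∷ 5 ∷ 7 ∷ []) ∷ []
pattern-for 11 2 = (3 ∷ 5 ∷ 7 ∷ 9 ∷ []) ∷ (0 ∷ []) ∷ [] ∷ (2 ∷ 4 ∷ 6 ∷ 8 ∷ []) ∷ (10 ∷ []) ∷ (1 ∷ []) ∷ []
pattern-for 11 3 = [] ∷ (0 ∷ 3 ∷ 5 ∷ 7 ∷ 9 ∷ []) ∷ [] ∷ (2 ∷ []) ∷ (4 ∷ 6 ∷ 8 ∷ 10 ∷ []) ∷ (1 ∷ []) ∷ []
pattern-for 11 4 = (9 ∷ []) ∷ (0 ∷ 4 ∷ []) ∷ (3 ∷ 6 ∷ []) ∷ (8 ∷ []) ∷ (2 ∷ 5 ∷ 10 ∷ []) ∷ (1 ∷ 7 ∷ []) ∷ []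
pattern-for 11 5 = (4 ∷ 9 ∷ []) ∷ (0 ∷ 3 ∷ []) ∷ (6 ∷ []) ∷ (2 ∷ 8 ∷ []) ∷ (5 ∷ 10 ∷ []) ∷ (1 ∷ 7 ∷ []) ∷ []
pattern-for 11 6 = (9 ∷ []) ∷ (0 ∷ 3 ∷ []) ∷ (6 ∷ []) ∷ (2 ∷ 5 ∷ 8 ∷ []) ∷ (10 ∷ []) ∷ (1 ∷ 4 ∷ 7 ∷ []) ∷ []
pattern-for 11 7 = (9 ∷ []) ∷ (0 ∷ 3 ∷ 6 ∷ []) ∷ [] ∷ (2 ∷ 5 ∷ 8 ∷ []) ∷ (10 ∷ []) ∷ (1 ∷ 4 ∷ 7 ∷ []) ∷ []
pattern-for 11 8 = (9 ∷ []) ∷ (0 ∷ 3 ∷ 6 ∷ []) ∷ [] ∷ (2 ∷ 5 ∷ 8 ∷ []) ∷ (10 ∷ []) ∷ (1 ∷ 4 ∷ 7 ∷ []) ∷ []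
pattern-for 11 9 = [] ∷ (0 ∷ 3 ∷ 6 ∷ 9 ∷ []) ∷ [] ∷ (2 ∷ 5 ∷ 8 ∷ []) ∷ (10 ∷ []) ∷ (1 ∷ 4 ∷ 7 ∷ []) ∷ []
pattern-for 11 10 = [] ∷ (0 ∷ 4 ∷ 8 ∷ []) ∷ (3 ∷ 7 ∷ []) ∷ [] ∷ (2 ∷ 6 ∷ 10 ∷ []) ∷ (1 ∷ 5 ∷ 9 ∷ []) ∷ []
pattern-for 12 0 = (9 ∷ []) ∷ (0 ∷ 3 ∷ 6 ∷ []) ∷ []
pattern-for 12 1 = (9 ∷ []) ∷ (0 ∷ 3 ∷ 6 ∷ []) ∷ []
pattern-for 12 2 = (9 ∷ []) ∷ (0 ∷ 3 ∷ 6 ∷ []) ∷ []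
pattern-for 12 3 = (9 ∷ []) ∷ (0 ∷ 3 ∷ 6 ∷ []) ∷ []
pattern-for 12 4 = (9 ∷ []) ∷ (0 ∷ 3 ∷ 6 ∷ []) ∷ []
pattern-for 12 5 = (9 ∷ []) ∷ (0 ∷ 3 ∷ 6 ∷ []) ∷ []
pattern-for 12 6 = (9 ∷ []) ∷ (0 ∷ 3 ∷ 6 ∷ []) ∷ []
pattern-for 12 7 = (9 ∷ []) ∷ (0 ∷ 3 ∷ 6 ∷ []) ∷ []
pattern-for 12 8 = (9 ∷ []) ∷ (0 ∷ 3 ∷ 6 ∷ []) ∷ []
pattern-for 12 9 = (9 ∷ []) ∷ (0 ∷ 3 ∷ 6 ∷ []) ∷ []
pattern-for 12 10 = (9 ∷ []) ∷ (0 ∷ 3 ∷ 6 ∷ []) ∷ []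
pattern-for 12 11 = (9 ∷ []) ∷ (0 ∷ 3 ∷ 6 ∷ []) ∷ []
pattern-for _ _ = [] ∷ []

-- Validity of all 75 patterns, certified by evaluating the decision procedure
-- (widths written as 3 + i with i < 10).
all-patterns-valid : ∀ {i} → i < 10 → ∀ {k} → k < 3 + i → Valid (3 + i) k (pattern-for (3 + i) k)
all-patterns-valid =
  from-yes (allUpTo? (λ i → allUpTo? (λ k → valid? (3 + i) k (pattern-for (3 + i) k)) (3 + i)) 10)

-- Lemma 2.6: the interior of a (w,ℓ,k)-cylinder with 3 ≤ w ≤ 12 is dominated
-- by at most w(ℓ+1)/6 + 12 vertices.
lemma26 : (w ℓ k : ℕ) → .{{_ : NonZero w}} → 3 ≤ w → w ≤ 12 → 1 ≤ ℓ → k < w →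
    Σ (List Vertex) (λ S → All (IsVertex w ℓ) S × DominatesInterior w ℓ k S
      × 6 * length S ≤ w * suc ℓ + 72)
lemma26 (suc (suc (suc i))) ℓ k (s≤s (s≤s (s≤s z≤n))) (s≤s (s≤s (s≤s i≤9))) _ k<w =
  S , S-vertices , S-dominates , S-size
  where open FromValidPattern (3 + i) ℓ k (pattern-for (3 + i) k) (all-patterns-valid (s≤s i≤9) k<w)
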